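{- Let $n \geq 2$ be an integer with distinct proper divisors $k_1, \ldots, k_d$, and for $1 \le i \le d$ let $\mathcal{A}_{k_i} = \{x \in \mathbb{Z}_n : \gcd(x,n) = k_i\}$ and let $\Gamma'(\mathcal{A}_{k_i})$ denote the induced subgraph of the cozero-divisor graph $\Gamma'(\mathbb{Z}_n)$ on $\mathcal{A}_{k_i}$. Then $$\Gamma'(\mathbb{Z}_n) = \Upsilon'_n[\Gamma'(\mathcal{A}_{k_1}), \Gamma'(\mathcal{A}_{k_2}), \ldots, \Gamma'(\mathcal{A}_{k_d})],$$ where the vertex $k_i$ of $\Upsilon'_n$ is replaced by $\Gamma'(\mathcal{A}_{k_i})$.
   Context: For a commutative ring $R$ with unity, the cozero-divisor graph $\Gamma'(R)$ has as vertices the non-zero non-unit elements of $R$, distinct $x, y$ adjacent iff $x \notin Ry$ and $y \notin Rx$. A proper divisor of $n$ is an integer $k$ with $k \mid n$ and $1<k<n$. $\Upsilon'_n$ is the simple graph on the proper divisors $k_1,\dots,k_d$ of $n$ in which distinct $k_i, k_j$ are adjacent iff $k_i \nmid k_j$ and $k_j \nmid k_i$. For a graph $\Gamma$ with vertices $u_1, \ldots, u_k$ and pairwise disjoint graphs $\Gamma_1, \ldots, \Gamma_k$, the generalized join $\Gamma[\Gamma_1, \ldots, \Gamma_k]$ is the graph obtained by replacing each vertex $u_i$ by $\Gamma_i$ and joining every vertex of $\Gamma_i$ to every vertex of $\Gamma_j$ whenever $u_i \sim u_j$ in $\Gamma$. -}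

module Defs where

open import Data.Nat using (ℕ; _*_; _<_; _≤_; NonZero)
open import Data.Nat.DivMod using (_%_)
open import Data.Nat.Divisibility using (_∣_)
open import Data.Nat.GCD using (gcd)
open import Data.Fin using (Fin; toℕ)
open import Data.Product using (Σ; _×_; ∃)
open import Data.Sum using (_⊎_)
open import Relation.Nullary using (¬_)
open import Relation.Binary.PropositionalEquality using (_≡_; _≢_)
open import Function.Bundles using (_⇔_)

-- A graph whose vertex set is a subset of an ambient type U.
-- Adj includes membership of both endpoints in the vertex set.
record Graph (U : Set) : Set₁ where
  field
    Vert : U → Set
    Adj  : U → U → Set
open Graph public

GraphEq : {U : Set} → Graph U → Graph U → Set
GraphEq G H = (∀ x → Vert G x ⇔ Vert H x) × (∀ x y → Adj G x y ⇔ Adj H x y)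

Induced : {U : Set} → Graph U → (U → Set) → Graph U
Vert (Induced G S) x = Vert G x × S x
Adj  (Induced G S) x y = Adj G x y × S x × S y

-- Generalized join Γ[Γ_w]: Γ has vertices in W, each vertex w replaced by
-- the graph F w (whose vertices live in the common ambient type U; the
-- paper's Γ_i are pairwise disjoint subgraphs).
GenJoin : {W U : Set} → Graph W → (W → Graph U) → Graph U
Vert (GenJoin Γ F) x = Σ _ λ w → Vert Γ w × Vert (F w) x
Adj  (GenJoin Γ F) x y =
  (Σ _ λ w → Vert Γ w × Adj (F w) x y)
  ⊎ (Σ _ λ w → Σ _ λ w' → Adj Γ w w' × Vert (F w) x × Vert (F w') y)

-- The ring ℤ_n, realised on Fin n with multiplication modulo n.
module _ (n : ℕ) {{_ : NonZero n}} where

  InIdeal : Fin n → Fin n → Set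
  InIdeal x y = ∃ λ (r : Fin n) → (toℕ r * toℕ y) % n ≡ toℕ x

  IsUnit : Fin n → Set
  IsUnit x = ∃ λ (r : Fin n) → (toℕ r * toℕ x) % n ≡ 1 % n

  CozeroGraph : Graph (Fin n)
  Vert CozeroGraph x = (toℕ x ≢ 0) × ¬ IsUnit x
  Adj  CozeroGraph x y =
    Vert CozeroGraph x × Vert CozeroGraph y × x ≢ y
    × ¬ InIdeal x y × ¬ InIdeal y x

  A : ℕ → Fin n → Set
  A k x = gcd (toℕ x) n ≡ k

ProperDivisor : ℕ → ℕ → Set
ProperDivisor n k = k ∣ n × 1 < k × k < n

Upsilon' : ℕ → Graph ℕ
Vert (Upsilon' n) k = ProperDivisor n k
Adj  (Upsilon' n) k j =
  ProperDivisor n k × ProperDivisor n j × k ≢ j × ¬ (k ∣ j) × ¬ (j ∣ k)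

{-# OPTIONS --safe #-}
module Submission where

open import Defs
open import Data.Nat using (ℕ; suc; _+_; _*_; _≤_; _<_; NonZero; ≢-nonZero; ≢-nonZero⁻¹)
open import Data.Nat.Properties using (_≟_; *-comm; *-assoc; ≤∧≢⇒<; n≢0⇒n>0; <⇒≱)
open import Data.Nat.DivMod using (_%_; %-distribˡ-*; %-congˡ; m%n%n≡m%n; [m+kn]%n≡m%n; m%n<n; m<n⇒m%n≡m)
open import Data.Nat.Divisibility using (_∣_; divides; ∣-trans; ∣-refl; ∣⇒≤; n∣m*n; %-presˡ-∣)
open import Data.Nat.GCD using (gcd; gcd-GCD; gcd[m,n]∣m; gcd[m,n]∣n; gcd-greatest; gcd[m,n]≢0; module Bézout)
open import Data.Nat.Tactic.RingSolver using (solve-∀)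
open import Data.Fin using (Fin; toℕ; fromℕ<)
open import Data.Fin.Properties using (toℕ<n; toℕ-fromℕ<)
open import Data.Product using (∃; _,_)
open import Data.Sum using (inj₁; inj₂)
open import Relation.Nullary using (yes; no)
open import Relation.Binary.PropositionalEquality using (_≡_; _≢_; refl; sym; trans; cong; subst; subst₂; module ≡-Reasoning)
open import Function.Bundles using (_⇔_; mk⇔; Equivalence)

-- In ℤₙ the principal ideal generated by y is the set of multiples of gcd(y, n) (Bézout),
-- so x ∈ Ry holds exactly when gcd(y, n) ∣ gcd(x, n).  Hence whether two vertices of
-- Γ'(ℤₙ) are adjacent depends only on their gcds with n, unless those gcds coincide:
-- the vertex x lies in the class 𝒜_k of k = gcd(x, n), a proper divisor of n because x
-- is a non-zero non-unit, and two classes are completely joined exactly when their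
-- divisors are incomparable, i.e. adjacent in Υ'ₙ.

*-%-congˡ : ∀ c {a b} n .{{_ : NonZero n}} → a % n ≡ b % n → (c * a) % n ≡ (c * b) % n
*-%-congˡ c {a} {b} n a≡b = begin
  (c * a) % n                ≡⟨ %-distribˡ-* c a n ⟩
  ((c % n) * (a % n)) % n    ≡⟨ cong (λ t → ((c % n) * t) % n) a≡b ⟩
  ((c % n) * (b % n)) % n    ≡⟨ %-distribˡ-* c b n ⟨
  (c * b) % n                ∎
  where open ≡-Reasoning

multiple≡gcd-mod : ∀ y n .{{_ : NonZero n}} → ∃ λ a → (a * y) % n ≡ gcd y n % n
multiple≡gcd-mod y n@(suc k) with Bézout.identity (gcd-GCD y n)
... | Bézout.+- a b d+bn≡ay = a , trans (%-congˡ (sym d+bn≡ay)) ([m+kn]%n≡m%n (gcd y n) b n)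
-- here a·y ≡ −d (mod n), so (n − 1)·a·y ≡ d
... | Bézout.-+ a b d+ay≡bn = k * a , (begin
  (k * a * y) % n                  ≡⟨ [m+kn]%n≡m%n (k * a * y) b n ⟨
  (k * a * y + b * n) % n          ≡⟨ cong (λ t → (k * a * y + t) % n) d+ay≡bn ⟨
  (k * a * y + (d + a * y)) % n    ≡⟨ %-congˡ (regroup k a y d) ⟩
  (d + (a * y) * n) % n            ≡⟨ [m+kn]%n≡m%n d (a * y) n ⟩
  d % n                            ∎)
  where
  open ≡-Reasoning
  d : ℕ
  d = gcd y n
  regroup : ∀ k a y d → k * a * y + (d + a * y) ≡ d + (a * y) * suc k
  regroup = solve-∀

mod-witness : ∀ {y t} r n .{{_ : NonZero n}} → (r * y) % n ≡ t → ∃ λ (s : Fin n) → (toℕ s * y) % n ≡ t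
mod-witness {y} r n ry≡t = fromℕ< (m%n<n r n) , (begin
  (toℕ (fromℕ< (m%n<n r n)) * y) % n   ≡⟨ %-congˡ (cong (_* y) (toℕ-fromℕ< (m%n<n r n))) ⟩
  ((r % n) * y) % n                     ≡⟨ %-congˡ (*-comm (r % n) y) ⟩
  (y * (r % n)) % n                     ≡⟨ *-%-congˡ y n (m%n%n≡m%n r n) ⟩
  (y * r) % n                           ≡⟨ %-congˡ (*-comm y r) ⟩
  (r * y) % n                           ≡⟨ ry≡t ⟩
  _                                     ∎)
  where open ≡-Reasoning

linear-congruence : ∀ y m n .{{_ : NonZero n}} → gcd y n ∣ m → ∃ λ (r : Fin n) → (toℕ r * y) % n ≡ m % n
linear-congruence y m n (divides c refl) with multiple≡gcd-mod y n
... | a , ay≡d = mod-witness (c * a) n (begin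
  (c * a * y) % n      ≡⟨ %-congˡ (*-assoc c a y) ⟩
  (c * (a * y)) % n    ≡⟨ *-%-congˡ c n ay≡d ⟩
  (c * gcd y n) % n    ∎)
  where open ≡-Reasoning

module _ (n : ℕ) {{_ : NonZero n}} where

  InIdeal⇒gcd∣ : ∀ x y → InIdeal n x y → gcd (toℕ y) n ∣ toℕ x
  InIdeal⇒gcd∣ x y (r , ry%n≡x) = subst (gcd (toℕ y) n ∣_) ry%n≡x
    (%-presˡ-∣ (∣-trans (gcd[m,n]∣m (toℕ y) n) (n∣m*n (toℕ r))) (gcd[m,n]∣n (toℕ y) n))

  InIdeal⇔gcd∣gcd : ∀ x y → InIdeal n x y ⇔ gcd (toℕ y) n ∣ gcd (toℕ x) n
  InIdeal⇔gcd∣gcd x y = mk⇔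
    (λ x∈Ry → gcd-greatest (InIdeal⇒gcd∣ x y x∈Ry) (gcd[m,n]∣n (toℕ y) n))
    (λ gy∣gx → let r , ry≡x = linear-congruence (toℕ y) (toℕ x) n (∣-trans gy∣gx (gcd[m,n]∣m (toℕ x) n))
               in r , trans ry≡x (m<n⇒m%n≡m (toℕ<n x)))

  gcd≡1⇒IsUnit : ∀ x → gcd (toℕ x) n ≡ 1 → IsUnit n x
  gcd≡1⇒IsUnit x g≡1 = linear-congruence (toℕ x) 1 n (subst (_∣ 1) (sym g≡1) ∣-refl)

  gcd-properDivisor : ∀ x → Vert (CozeroGraph n) x → ProperDivisor n (gcd (toℕ x) n)
  gcd-properDivisor x (x≢0 , nonUnit) = gcd[m,n]∣n (toℕ x) n , 1<g , g<n
    where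
    g : ℕ
    g = gcd (toℕ x) n
    1<g : 1 < g
    1<g = ≤∧≢⇒< (n≢0⇒n>0 (gcd[m,n]≢0 (toℕ x) n (inj₂ (≢-nonZero⁻¹ n))))
                (λ 1≡g → nonUnit (gcd≡1⇒IsUnit x (sym 1≡g)))
    g≢n : g ≢ n
    g≢n g≡n = <⇒≱ (toℕ<n x) (∣⇒≤ {{≢-nonZero x≢0}} (subst (_∣ toℕ x) g≡n (gcd[m,n]∣m (toℕ x) n)))
    g<n : g < n
    g<n = ≤∧≢⇒< (∣⇒≤ (gcd[m,n]∣n (toℕ x) n)) g≢n

  𝒜-join : Graph (Fin n)
  𝒜-join = GenJoin (Upsilon' n) (λ k → Induced (CozeroGraph n) (A n k))

  Adj-cozero⇒Adj-𝒜-join : ∀ x y → Adj (CozeroGraph n) x y → Adj 𝒜-join x y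
  Adj-cozero⇒Adj-𝒜-join x y adj@(vx , vy , _ , x∉Ry , y∉Rx) with gcd (toℕ x) n ≟ gcd (toℕ y) n
  ... | yes gx≡gy = inj₁ (gcd (toℕ x) n , gcd-properDivisor x vx , adj , refl , sym gx≡gy)
  ... | no gx≢gy = inj₂ (gcd (toℕ x) n , gcd (toℕ y) n
        , (gcd-properDivisor x vx , gcd-properDivisor y vy , gx≢gy
          , (λ gx∣gy → y∉Rx (Equivalence.from (InIdeal⇔gcd∣gcd y x) gx∣gy))
          , (λ gy∣gx → x∉Ry (Equivalence.from (InIdeal⇔gcd∣gcd x y) gy∣gx)))
        , (vx , refl) , (vy , refl))

  Adj-𝒜-join⇒Adj-cozero : ∀ x y → Adj 𝒜-join x y → Adj (CozeroGraph n) x y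
  Adj-𝒜-join⇒Adj-cozero x y (inj₁ (_ , _ , adj , _)) = adj
  Adj-𝒜-join⇒Adj-cozero x y (inj₂ (k , j , (_ , _ , k≢j , k∤j , j∤k) , (vx , gx≡k) , (vy , gy≡j))) =
    vx , vy , (λ { refl → k≢j (trans (sym gx≡k) gy≡j) })
    , (λ x∈Ry → j∤k (subst₂ _∣_ gy≡j gx≡k (Equivalence.to (InIdeal⇔gcd∣gcd x y) x∈Ry)))
    , (λ y∈Rx → k∤j (subst₂ _∣_ gx≡k gy≡j (Equivalence.to (InIdeal⇔gcd∣gcd y x) y∈Rx)))

mainTheorem4 : (n : ℕ) {{_ : NonZero n}} → 2 ≤ n →
    GraphEq (CozeroGraph n) (GenJoin (Upsilon' n) (λ k → Induced (CozeroGraph n) (A n k)))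
mainTheorem4 n _ =
    (λ x → mk⇔ (λ v → gcd (toℕ x) n , gcd-properDivisor n x v , v , refl) (λ { (_ , _ , v , _) → v }))
  , (λ x y → mk⇔ (Adj-cozero⇒Adj-𝒜-join n x y) (Adj-𝒜-join⇒Adj-cozero n x y))
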